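{- Let $G$ be a 1-planar graph, $D(G)$ a 1-planar drawing of $G$, and $e=xy$ and $e'=x'y'$ two crossing edges of $D(G)$. Let $G'$ be obtained from $G$ by turning the crossing of $e$ and $e'$ into a new 4-valent vertex $v$ (i.e. deleting $e$ and $e'$ and adding a new vertex $v$ adjacent to $x,y,x',y'$). (a) If this crossing is full and $G'$ has a hamiltonian cycle (respectively hamiltonian path), then $G$ is hamiltonian (respectively traceable). (b) If this crossing is almost full with $xx' \notin E(G)$, and $G'$ has a hamiltonian cycle (respectively hamiltonian path) not containing both edges $vx$ and $vx'$, then $G$ is hamiltonian (respectively traceable).
   Context: All graphs are finite and simple. A 1-planar drawing is a drawing in the plane in which each edge is crossed at most once by another edge; two crossing edges cross exactly once and have four distinct end vertices. A crossing is full if the four end vertices of its two edges induce $K_4$, and almost full if they induce $K_4^-$ ($K_4$ minus one edge). A graph is traceable if it has a path containing all its vertices. -}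

module Defs where

open import Level using (0ℓ)
open import Data.Nat using (ℕ; zero; suc; _≤_)
open import Data.Fin using (Fin; zero; suc; toℕ)
open import Data.Product using (Σ; ∃; _×_; _,_)
open import Data.Sum using (_⊎_; inj₁; inj₂)
open import Data.Empty using (⊥)
open import Relation.Nullary using (¬_)
open import Relation.Binary.PropositionalEquality using (_≡_; refl)
open import Function.Definitions using (Injective)

record Graph (n : ℕ) : Set₁ where
  field
    Adj    : Fin n → Fin n → Set
    adj-sym : ∀ {u w} → Adj u w → Adj w u
    adj-irrefl : ∀ {u} → ¬ Adj u u
open Graph public

SameEdge : ∀ {n} → Fin n → Fin n → Fin n → Fin n → Set
SameEdge i j a b = (i ≡ a × j ≡ b) ⊎ (i ≡ b × j ≡ a)

SameEdge-sym : ∀ {n} {i j a b : Fin n} → SameEdge i j a b → SameEdge j i a b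
SameEdge-sym (inj₁ (p , q)) = inj₂ (q , p)
SameEdge-sym (inj₂ (p , q)) = inj₁ (q , p)

-- Turning the crossing of edges xy and x'y' into a new vertex v:
-- the new vertex v is `zero`, old vertex i is `suc i`.
-- The edges xy and x'y' are deleted and v is joined to x, y, x', y'.
NewAdj : ∀ {n} → Graph n → (x y x' y' : Fin n) → Fin (suc n) → Fin (suc n) → Set
NewAdj G x y x' y' zero zero = ⊥
NewAdj G x y x' y' zero (suc i) = i ≡ x ⊎ i ≡ y ⊎ i ≡ x' ⊎ i ≡ y'
NewAdj G x y x' y' (suc i) zero = i ≡ x ⊎ i ≡ y ⊎ i ≡ x' ⊎ i ≡ y'
NewAdj G x y x' y' (suc i) (suc j) =
  Adj G i j × ¬ SameEdge i j x y × ¬ SameEdge i j x' y'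

NewAdj-sym : ∀ {n} (G : Graph n) (x y x' y' : Fin n) {u w : Fin (suc n)} →
  NewAdj G x y x' y' u w → NewAdj G x y x' y' w u
NewAdj-sym G x y x' y' {zero} {suc w} p = p
NewAdj-sym G x y x' y' {suc u} {zero} p = p
NewAdj-sym G x y x' y' {suc u} {suc w} (a , b , c) =
  adj-sym G a , (λ s → b (SameEdge-sym s)) , (λ s → c (SameEdge-sym s))

NewAdj-irrefl : ∀ {n} (G : Graph n) (x y x' y' : Fin n) {u : Fin (suc n)} →
  ¬ NewAdj G x y x' y' u u
NewAdj-irrefl G x y x' y' {zero} ()
NewAdj-irrefl G x y x' y' {suc u} (a , _) = adj-irrefl G a

splitCrossing : ∀ {n} → Graph n → (x y x' y' : Fin n) → Graph (suc n)
splitCrossing G x y x' y' = record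
  { Adj = NewAdj G x y x' y'
  ; adj-sym = NewAdj-sym G x y x' y'
  ; adj-irrefl = NewAdj-irrefl G x y x' y' }

newVertex : ∀ {n} → Fin (suc n)
newVertex = zero

old : ∀ {n} → Fin n → Fin (suc n)
old = suc

PathStep : ∀ {n} → Fin n → Fin n → Set
PathStep i j = toℕ j ≡ suc (toℕ i)

CycleStep : (n : ℕ) → Fin n → Fin n → Set
CycleStep n i j = PathStep i j ⊎ (suc (toℕ i) ≡ n × toℕ j ≡ 0)

record HamPath {n : ℕ} (G : Graph n) : Set where
  field
    order : Fin n → Fin n
    inj   : Injective _≡_ _≡_ order
    surj  : ∀ w → ∃ λ i → order i ≡ w
    adj   : ∀ i j → PathStep i j → Adj G (order i) (order j)

record HamCycle {n : ℕ} (G : Graph n) : Set where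
  field
    atLeast3 : 3 ≤ n
    order : Fin n → Fin n
    inj   : Injective _≡_ _≡_ order
    surj  : ∀ w → ∃ λ i → order i ≡ w
    adj   : ∀ i j → CycleStep n i j → Adj G (order i) (order j)

Hamiltonian : ∀ {n} → Graph n → Set
Hamiltonian G = HamCycle G

Traceable : ∀ {n} → Graph n → Set
Traceable G = HamPath G

PathUses : ∀ {n} {G : Graph n} → HamPath G → Fin n → Fin n → Set
PathUses {n} P a b = ∃ λ i → ∃ λ j → PathStep i j × SameEdge (order i) (order j) a b
  where open HamPath P

CycleUses : ∀ {n} {G : Graph n} → HamCycle G → Fin n → Fin n → Set
CycleUses {n} C a b = ∃ λ i → ∃ λ j → CycleStep n i j × SameEdge (order i) (order j) a b
  where open HamCycle C

Distinct4 : ∀ {n} → Fin n → Fin n → Fin n → Fin n → Set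
Distinct4 x y x' y' =
  ¬ x ≡ y × ¬ x ≡ x' × ¬ x ≡ y' × ¬ y ≡ x' × ¬ y ≡ y' × ¬ x' ≡ y'

FullCrossing : ∀ {n} → Graph n → Fin n → Fin n → Fin n → Fin n → Set
FullCrossing G x y x' y' =
  Adj G x y × Adj G x' y' × Adj G x x' × Adj G x y' × Adj G y x' × Adj G y y'

AlmostFullMissingXX' : ∀ {n} → Graph n → Fin n → Fin n → Fin n → Fin n → Set
AlmostFullMissingXX' G x y x' y' =
  Adj G x y × Adj G x' y' × ¬ Adj G x x' × Adj G x y' × Adj G y x' × Adj G y y'

module Submission where

-- Let C be a hamiltonian cycle (or path) of G', and let v be the
-- new vertex.  Deleting v from the cyclic order of C leaves an order of V(G) in
-- which every pair of consecutive vertices was already consecutive in C, and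
-- hence adjacent in G (G' - v is a subgraph of G), except for the two
-- neighbours a, b of v along C, which are now consecutive.  Both lie in
-- {x, y, x', y'}.  In a full crossing any two of these four vertices are
-- adjacent; in an almost full crossing all pairs are adjacent except xx', and
-- {a, b} = {x, x'} is excluded because C would then use both vx and vx'.

open import Defs
open import Data.Nat using (ℕ; zero; suc; _≤_; z≤n; s≤s)
open import Data.Nat.Properties using (<⇒≤)
import Data.Nat.Properties as ℕ
open import Data.Fin using (Fin; zero; suc; toℕ; punchIn; punchOut)
open import Data.Fin.Properties using (punchIn-injective; punchInᵢ≢i; punchIn-punchOut; suc-injective)
open import Data.Product using (∃; _×_; _,_; proj₁; proj₂)
import Data.Product as Product
open import Data.Sum using (_⊎_; inj₁; inj₂)
import Data.Sum as Sum
open import Data.Empty using (⊥-elim)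
open import Relation.Nullary using (¬_)
open import Relation.Binary.PropositionalEquality using (_≡_; _≢_; refl; sym; trans; cong; subst; subst₂)
open import Function.Definitions using (Injective)

pathStep-punchIn : ∀ {n} (k : Fin (suc n)) (i j : Fin n) → PathStep i j →
  PathStep (punchIn k i) (punchIn k j) ⊎ (PathStep (punchIn k i) k × PathStep k (punchIn k j))
pathStep-punchIn zero i j e = inj₁ (cong suc e)
pathStep-punchIn (suc k) zero zero ()
pathStep-punchIn (suc zero) zero (suc zero) e = inj₂ (refl , refl)
pathStep-punchIn (suc (suc k)) zero (suc zero) e = inj₁ refl
pathStep-punchIn (suc k) zero (suc (suc j)) ()
pathStep-punchIn (suc k) (suc i) zero ()
pathStep-punchIn (suc k) (suc i) (suc j) e =
  Sum.map (cong suc) (Product.map (cong suc) (cong suc)) (pathStep-punchIn k i j (ℕ.suc-injective e))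

punchIn-last : ∀ {n} (k : Fin (suc n)) (i : Fin n) → suc (toℕ i) ≡ n →
  toℕ (punchIn k i) ≡ n ⊎ (toℕ k ≡ n × toℕ (punchIn k i) ≡ toℕ i)
punchIn-last zero i e = inj₁ e
punchIn-last (suc zero) zero refl = inj₂ (refl , refl)
punchIn-last (suc (suc ())) zero refl
punchIn-last {suc n} (suc k) (suc i) e =
  Sum.map (cong suc) (Product.map (cong suc) (cong suc)) (punchIn-last k i (ℕ.suc-injective e))

cycleStep-punchIn : ∀ {n} (k : Fin (suc n)) (i j : Fin n) → CycleStep n i j →
  CycleStep (suc n) (punchIn k i) (punchIn k j)
    ⊎ (CycleStep (suc n) (punchIn k i) k × CycleStep (suc n) k (punchIn k j))
cycleStep-punchIn k i j (inj₁ e) = Sum.map inj₁ (Product.map inj₁ inj₁) (pathStep-punchIn k i j e)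
cycleStep-punchIn zero i j (inj₂ (ei , ej)) = inj₂ (inj₂ (cong suc ei , refl) , inj₁ (cong suc ej))
cycleStep-punchIn (suc k) i (suc j) (inj₂ (ei , ()))
cycleStep-punchIn (suc k) i zero (inj₂ (ei , refl)) with punchIn-last (suc k) i ei
... | inj₁ e = inj₁ (inj₂ (cong suc e , refl))
... | inj₂ (ek , e) = inj₂ (inj₁ (trans ek (trans (sym ei) (cong suc (sym e)))) , inj₂ (cong suc ek , refl))

pathStep-distinct : ∀ {n} {i j : Fin n} → PathStep i j → i ≢ j
pathStep-distinct e refl = ℕ.1+n≢n (sym e)

cycleStep-distinct : ∀ {n} → 2 ≤ n → {i j : Fin n} → CycleStep n i j → i ≢ j
cycleStep-distinct _ (inj₁ e) = pathStep-distinct e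
cycleStep-distinct h (inj₂ (ei , e0)) refl with subst (2 ≤_) (trans (sym ei) (cong suc e0)) h
... | s≤s ()

distinct3⇒3≤n : ∀ {n} (a b c : Fin n) → a ≢ b → a ≢ c → b ≢ c → 3 ≤ n
distinct3⇒3≤n {suc (suc (suc n))} _ _ _ _ _ _ = s≤s (s≤s (s≤s z≤n))
distinct3⇒3≤n {suc zero} zero zero _ ab _ _ = ⊥-elim (ab refl)
distinct3⇒3≤n {suc (suc zero)} zero zero _ ab _ _ = ⊥-elim (ab refl)
distinct3⇒3≤n {suc (suc zero)} (suc zero) (suc zero) _ ab _ _ = ⊥-elim (ab refl)
distinct3⇒3≤n {suc (suc zero)} zero (suc zero) zero _ ac _ = ⊥-elim (ac refl)
distinct3⇒3≤n {suc (suc zero)} zero (suc zero) (suc zero) _ _ bc = ⊥-elim (bc refl)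
distinct3⇒3≤n {suc (suc zero)} (suc zero) zero zero _ _ bc = ⊥-elim (bc refl)
distinct3⇒3≤n {suc (suc zero)} (suc zero) zero (suc zero) _ ac _ = ⊥-elim (ac refl)

Flank : ∀ {n} → (Fin (suc n) → Fin (suc n) → Set) → (Fin (suc n) → Fin (suc n)) →
  Fin n → Fin n → Set
Flank Step order a b = ∃ λ p → ∃ λ k → ∃ λ q →
  Step p k × Step k q × order p ≡ suc a × order k ≡ zero × order q ≡ suc b

Uses : ∀ {m} → (Fin m → Fin m → Set) → (Fin m → Fin m) → Fin m → Fin m → Set
Uses Step order a b = ∃ λ i → ∃ λ j → Step i j × SameEdge (order i) (order j) a b

flank-uses : ∀ {n} {Step : Fin (suc n) → Fin (suc n) → Set} {order} {a b : Fin n} →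
  Flank Step order a b → Uses Step order zero (suc a) × Uses Step order zero (suc b)
flank-uses (p , k , q , s , t , ep , ek , eq) = (p , k , s , inj₂ (ep , ek)) , (k , q , t , inj₁ (ek , eq))

module Bypass {n} (H : Graph (suc n)) (G : Graph n)
  (restrict : ∀ {a b} → Adj H (suc a) (suc b) → Adj G a b)
  (order : Fin (suc n) → Fin (suc n)) (inj : Injective _≡_ _≡_ order)
  (surj : ∀ w → ∃ λ i → order i ≡ w) where

  k : Fin (suc n)
  k = proj₁ (surj zero)

  holds-old : ∀ i → zero ≢ order (punchIn k i)
  holds-old i e = punchInᵢ≢i k i (inj (trans (sym e) (sym (proj₂ (surj zero)))))

  shorten : Fin n → Fin n
  shorten i = punchOut (holds-old i)

  shorten-spec : ∀ i → order (punchIn k i) ≡ suc (shorten i)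
  shorten-spec i = sym (punchIn-punchOut (holds-old i))

  shorten-inj : Injective _≡_ _≡_ shorten
  shorten-inj {i} {j} e =
    punchIn-injective k i j (inj (trans (shorten-spec i) (trans (cong suc e) (sym (shorten-spec j)))))

  shorten-surj : ∀ w → ∃ λ i → shorten i ≡ w
  shorten-surj w with surj (suc w)
  ... | p , e = punchOut k≢p , suc-injective hits-w
    where
    k≢p : k ≢ p
    k≢p refl with trans (sym (proj₂ (surj zero))) e
    ... | ()
    hits-w : suc (shorten (punchOut k≢p)) ≡ suc w
    hits-w = trans (sym (shorten-spec _)) (trans (cong order (punchIn-punchOut k≢p)) e)

  shorten-adj : (Step′ : Fin n → Fin n → Set) (Step : Fin (suc n) → Fin (suc n) → Set) →
    (∀ {i j} → Step′ i j → i ≢ j) →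
    (∀ {i j} → Step′ i j →
      Step (punchIn k i) (punchIn k j) ⊎ (Step (punchIn k i) k × Step k (punchIn k j))) →
    (∀ i j → Step i j → Adj H (order i) (order j)) →
    (∀ {a b} → Flank Step order a b → a ≢ b → Adj G a b) →
    ∀ i j → Step′ i j → Adj G (shorten i) (shorten j)
  shorten-adj Step′ Step distinct split adj bypass i j st with split st
  ... | inj₁ s = restrict (subst₂ (Adj H) (shorten-spec i) (shorten-spec j) (adj _ _ s))
  ... | inj₂ (s , t) = bypass (punchIn k i , k , punchIn k j , s , t ,
                               shorten-spec i , proj₂ (surj zero) , shorten-spec j)
                              (λ e → distinct st (shorten-inj e))

bypassPath : ∀ {n} (H : Graph (suc n)) (G : Graph n) →
  (∀ {a b} → Adj H (suc a) (suc b) → Adj G a b) → (P : HamPath H) →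
  (∀ {a b} → Flank PathStep (HamPath.order P) a b → a ≢ b → Adj G a b) → HamPath G
bypassPath H G restrict P bypass = record
  { order = shorten ; inj = shorten-inj ; surj = shorten-surj
  ; adj = shorten-adj PathStep PathStep pathStep-distinct (pathStep-punchIn k _ _) adj bypass }
  where
  open HamPath P
  open Bypass H G restrict order inj surj

bypassCycle : ∀ {n} (H : Graph (suc n)) (G : Graph n) →
  (∀ {a b} → Adj H (suc a) (suc b) → Adj G a b) → 3 ≤ n → (C : HamCycle H) →
  (∀ {a b} → Flank (CycleStep (suc n)) (HamCycle.order C) a b → a ≢ b → Adj G a b) →
  HamCycle G
bypassCycle {n} H G restrict 3≤n C bypass = record
  { atLeast3 = 3≤n ; order = shorten ; inj = shorten-inj ; surj = shorten-surj
  ; adj = shorten-adj (CycleStep n) (CycleStep (suc n)) (cycleStep-distinct (<⇒≤ 3≤n))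
                      (cycleStep-punchIn k _ _) adj bypass }
  where
  open HamCycle C
  open Bypass H G restrict order inj surj

CrossingVertex : ∀ {n} → Fin n → Fin n → Fin n → Fin n → Fin n → Set
CrossingVertex x y x' y' a = a ≡ x ⊎ a ≡ y ⊎ a ≡ x' ⊎ a ≡ y'

K4Minus : ∀ {n} → Graph n → Fin n → Fin n → Fin n → Fin n → Set
K4Minus G x y x' y' = Adj G x y × Adj G x' y' × Adj G x y' × Adj G y x' × Adj G y y'

crossing-adj : ∀ {n} (G : Graph n) {x y x' y' a b : Fin n} → K4Minus G x y x' y' →
  CrossingVertex x y x' y' a → CrossingVertex x y x' y' b → a ≢ b →
  Adj G a b ⊎ SameEdge a b x x'
crossing-adj G {x} {y} {x'} {y'} (xy , x'y' , xy' , yx' , yy') = cases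
  where
  sym′ : ∀ {u w} → Adj G u w → Adj G w u
  sym′ = adj-sym G
  cases : ∀ {a b} → CrossingVertex x y x' y' a → CrossingVertex x y x' y' b → a ≢ b →
    Adj G a b ⊎ SameEdge a b x x'
  cases (inj₁ refl)               (inj₁ refl)               ne = ⊥-elim (ne refl)
  cases (inj₁ refl)               (inj₂ (inj₁ refl))        _  = inj₁ xy
  cases (inj₁ refl)               (inj₂ (inj₂ (inj₁ refl))) _  = inj₂ (inj₁ (refl , refl))
  cases (inj₁ refl)               (inj₂ (inj₂ (inj₂ refl))) _  = inj₁ xy'
  cases (inj₂ (inj₁ refl))        (inj₁ refl)               _  = inj₁ (sym′ xy)
  cases (inj₂ (inj₁ refl))        (inj₂ (inj₁ refl))        ne = ⊥-elim (ne refl)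
  cases (inj₂ (inj₁ refl))        (inj₂ (inj₂ (inj₁ refl))) _  = inj₁ yx'
  cases (inj₂ (inj₁ refl))        (inj₂ (inj₂ (inj₂ refl))) _  = inj₁ yy'
  cases (inj₂ (inj₂ (inj₁ refl))) (inj₁ refl)               _  = inj₂ (inj₂ (refl , refl))
  cases (inj₂ (inj₂ (inj₁ refl))) (inj₂ (inj₁ refl))        _  = inj₁ (sym′ yx')
  cases (inj₂ (inj₂ (inj₁ refl))) (inj₂ (inj₂ (inj₁ refl))) ne = ⊥-elim (ne refl)
  cases (inj₂ (inj₂ (inj₁ refl))) (inj₂ (inj₂ (inj₂ refl))) _  = inj₁ x'y'
  cases (inj₂ (inj₂ (inj₂ refl))) (inj₁ refl)               _  = inj₁ (sym′ xy')
  cases (inj₂ (inj₂ (inj₂ refl))) (inj₂ (inj₁ refl))        _  = inj₁ (sym′ yy')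
  cases (inj₂ (inj₂ (inj₂ refl))) (inj₂ (inj₂ (inj₁ refl))) _  = inj₁ (sym′ x'y')
  cases (inj₂ (inj₂ (inj₂ refl))) (inj₂ (inj₂ (inj₂ refl))) ne = ⊥-elim (ne refl)

-- Splitting the crossing: G' - v is a subgraph of G, and the vertices flanking
-- v in any vertex order of G' are crossing vertices; so whenever the pair {x, x'}
-- causes no trouble, the flanking vertices are adjacent in G.
module _ {n} (G : Graph n) {x y x' y' : Fin n} where
  private
    G' : Graph (suc n)
    G' = splitCrossing G x y x' y'

  split-restrict : ∀ {a b} → Adj G' (suc a) (suc b) → Adj G a b
  split-restrict = proj₁

  split-bypass : K4Minus G x y x' y' →
    {Step : Fin (suc n) → Fin (suc n) → Set} {order : Fin (suc n) → Fin (suc n)} →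
    (∀ i j → Step i j → Adj G' (order i) (order j)) →
    (∀ {a b} → Flank Step order a b → SameEdge a b x x' → Adj G a b) →
    ∀ {a b} → Flank Step order a b → a ≢ b → Adj G a b
  split-bypass k4 adj xx' fl@(p , k , q , s , t , ep , ek , eq) ne
    with crossing-adj G k4 (subst₂ (Adj G') ep ek (adj _ _ s)) (subst₂ (Adj G') ek eq (adj _ _ t)) ne
  ... | inj₁ ab = ab
  ... | inj₂ e = xx' fl e

full-xx' : ∀ {n} (G : Graph n) {x x' a b : Fin n} → Adj G x x' → SameEdge a b x x' → Adj G a b
full-xx' G xx' (inj₁ (refl , refl)) = xx'
full-xx' G xx' (inj₂ (refl , refl)) = adj-sym G xx'

avoid-xx' : ∀ {n} {Step : Fin (suc n) → Fin (suc n) → Set} {order} {x x' a b : Fin n} →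
  ¬ (Uses Step order zero (suc x) × Uses Step order zero (suc x')) →
  Flank Step order a b → ¬ SameEdge a b x x'
avoid-xx' avoid fl (inj₁ (refl , refl)) = avoid (flank-uses fl)
avoid-xx' avoid fl (inj₂ (refl , refl)) = avoid (Product.swap (flank-uses fl))

lemma3 : ∀ (n : ℕ) (G : Graph n) (x y x' y' : Fin n) →
    Distinct4 x y x' y' → Adj G x y → Adj G x' y' →
    ((FullCrossing G x y x' y' →
    (HamCycle (splitCrossing G x y x' y') → Hamiltonian G)
    × (HamPath (splitCrossing G x y x' y') → Traceable G))
    × (AlmostFullMissingXX' G x y x' y' →
    ((C : HamCycle (splitCrossing G x y x' y')) →
    ¬ (CycleUses C newVertex (old x) × CycleUses C newVertex (old x')) →
    Hamiltonian G)
    × ((P : HamPath (splitCrossing G x y x' y')) →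
    ¬ (PathUses P newVertex (old x) × PathUses P newVertex (old x')) →
    Traceable G)))
lemma3 n G x y x' y' (x≢y , x≢x' , _ , y≢x' , _) _ _ = full , almostFull
  where
  G' : Graph (suc n)
  G' = splitCrossing G x y x' y'

  3≤n : 3 ≤ n
  3≤n = distinct3⇒3≤n x y x' x≢y x≢x' y≢x'

  full : FullCrossing G x y x' y' →
    (HamCycle G' → HamCycle G) × (HamPath G' → HamPath G)
  full (xy , x'y' , xx' , xy' , yx' , yy') =
      (λ C → bypassCycle G' G (split-restrict G) 3≤n C (split-bypass G k4 (HamCycle.adj C) (λ _ → full-xx' G xx')))
    , (λ P → bypassPath G' G (split-restrict G) P (split-bypass G k4 (HamPath.adj P) (λ _ → full-xx' G xx')))
    where
    k4 : K4Minus G x y x' y'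
    k4 = xy , x'y' , xy' , yx' , yy'

  almostFull : AlmostFullMissingXX' G x y x' y' →
    ((C : HamCycle G') → ¬ (CycleUses C zero (suc x) × CycleUses C zero (suc x')) → HamCycle G)
    × ((P : HamPath G') → ¬ (PathUses P zero (suc x) × PathUses P zero (suc x')) → HamPath G)
  almostFull (xy , x'y' , _ , xy' , yx' , yy') =
      (λ C avoid → bypassCycle G' G (split-restrict G) 3≤n C
                     (split-bypass G k4 (HamCycle.adj C) (λ fl e → ⊥-elim (avoid-xx' avoid fl e))))
    , (λ P avoid → bypassPath G' G (split-restrict G) P
                     (split-bypass G k4 (HamPath.adj P) (λ fl e → ⊥-elim (avoid-xx' avoid fl e))))
    where
    k4 : K4Minus G x y x' y'
    k4 = xy , x'y' , xy' , yx' , yy'
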